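{- Let $n\geq 5$ be an integer, let $a$ be a real number with $0<a\leq \frac{1}{2}$ and $a\notin\left\{\frac{2}{n},\frac{4}{n}, \frac{1}{3}+\frac{4}{3n}\right\}$, and let $p,q,r$ be non-negative integers such that $2-\frac{4}{n}=pa+q(1-a)+r$. Then $p>q$, and $a\in\left\{ \frac{2-\frac{4}{n}}{s},\frac{1-\frac{4}{n}}{s}\right\}$ for some positive integer $s$.
   Formalization: The number a ranges over the rationals instead of the reals. -}

module Defs where

open import Data.Nat using (ℕ; zero; suc)
open import Data.Integer using (+_)
open import Data.Rational using (ℚ; _/_; 0ℚ)

ℕ→ℚ : ℕ → ℚ
ℕ→ℚ k = + k / 1

-- k / d as a rational; convention k / 0 = 0 (only ever used with d ≥ 1)
_/ℕ_ : ℕ → ℕ → ℚ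
k /ℕ zero = 0ℚ
k /ℕ suc d = + k / suc d

{-# OPTIONS --safe #-}
module Submission where

-- Write n = 4 + t and a = m / d with d = m + e, so that 1 − a = e / d and a ≤ ½ means m ≤ e.
-- Multiplying by n d turns 2 − 4/n = p a + q (1 − a) + r into p A + q B + r D = D + C in ℕ, where
-- A = n m ≤ B = n e, A + B = D = n d and 0 < C = t d < D (so C / D = 1 − 4/n).  Since D + C < 2 D,
-- r ≤ 1.  If r = 1, or r = 0 and p, q ≥ 1, removing D resp. A + B leaves p′ A + q′ B = C < A + B ≤ 2 B,
-- which forces q′ = 0 (q′ = 1, p′ = 0 would mean B = C, i.e. a = 4/n), so a = (1 − 4/n) / p′.
-- If r = q = 0 then a = (2 − 4/n) / p.  Finally r = p = 0 is impossible: q B = D + C lies strictly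
-- between B and 4 B, so q ∈ {2, 3}, i.e. a = 2/n or a = 1/3 + 4/(3n).

open import Defs
open import Data.Nat using (ℕ; _≤_; zero; suc; s≤s; z<s; NonZero; >-nonZero)
open import Data.Nat as ℕ using ()
import Data.Nat.Properties as ℕ
open import Data.Nat.Tactic.RingSolver using (solve; solve-∀)
open import Data.Integer as ℤ using (+_; -[1+_])
import Data.Integer.Properties as ℤ
import Data.Integer.Tactic.RingSolver as ℤ-Solver
open import Data.Rational using (ℚ; 0ℚ; 1ℚ; ½; _+_; _-_; _*_; _<_; mkℚ; -_; toℚᵘ; *≤*; *<*)
open import Data.Rational as ℚ using ()
import Data.Rational.Properties as ℚ
open import Data.Rational.Unnormalised as ℚᵘ using (*≡*)
import Data.Rational.Unnormalised.Properties as ℚᵘ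
open import Data.List.Base using (_∷_; [])
open import Data.Product using (_×_; _,_; ∃-syntax; ∃₂)
open import Data.Sum as Sum using (_⊎_; inj₁; inj₂)
open import Function using (_∘_)
open import Relation.Binary.PropositionalEquality
  using (_≡_; _≢_; refl; sym; trans; cong; cong₂; subst; module ≡-Reasoning)
open import Relation.Nullary using (contradiction)

module _ {A B C D : ℕ} (A≤B : A ≤ B) (A+B≡D : A ℕ.+ B ≡ D) (0<C : 0 ℕ.< C) (C<D : C ℕ.< D) where

  private
    D≤2*B : D ≤ 2 ℕ.* B
    D≤2*B = begin
      D        ≡⟨ A+B≡D ⟨
      A ℕ.+ B  ≤⟨ ℕ.+-monoˡ-≤ B A≤B ⟩
      B ℕ.+ B  ≡⟨ cong (B ℕ.+_) (ℕ.+-identityʳ B) ⟨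
      2 ℕ.* B  ∎
      where open ℕ.≤-Reasoning

    D+C<2*D : D ℕ.+ C ℕ.< 2 ℕ.* D
    D+C<2*D = subst (D ℕ.+ C ℕ.<_) (cong (D ℕ.+_) (sym (ℕ.+-identityʳ D))) (ℕ.+-monoʳ-< D C<D)

    cancel-D : ∀ {X} → X ℕ.+ D ≡ D ℕ.+ C → X ≡ C
    cancel-D {X} eq = ℕ.+-cancelʳ-≡ D X C (trans eq (ℕ.+-comm D C))

    split-A+B : ∀ p q → suc p ℕ.* A ℕ.+ suc q ℕ.* B ℕ.+ 0 ℕ.* D ≡ p ℕ.* A ℕ.+ q ℕ.* B ℕ.+ D
    split-A+B p q = begin
      suc p ℕ.* A ℕ.+ suc q ℕ.* B ℕ.+ 0 ℕ.* D  ≡⟨ solve (A ∷ B ∷ D ∷ p ∷ q ∷ []) ⟩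
      p ℕ.* A ℕ.+ q ℕ.* B ℕ.+ (A ℕ.+ B)        ≡⟨ cong (p ℕ.* A ℕ.+ q ℕ.* B ℕ.+_) A+B≡D ⟩
      p ℕ.* A ℕ.+ q ℕ.* B ℕ.+ D                ∎
      where open ≡-Reasoning

  combination-of-C : ∀ p q → B ≢ C → p ℕ.* A ℕ.+ q ℕ.* B ≡ C → q ≡ 0 × 0 ℕ.< p × p ℕ.* A ≡ C
  combination-of-C zero    zero          B≢C eq = contradiction eq (ℕ.<⇒≢ 0<C)
  combination-of-C (suc p) zero          B≢C eq = refl , z<s , trans (sym (ℕ.+-identityʳ _)) eq
  combination-of-C zero    (suc zero)    B≢C eq = contradiction (trans (sym (ℕ.+-identityʳ B)) eq) B≢C
  combination-of-C (suc p) (suc q)       B≢C eq = contradiction eq (ℕ.>⇒≢ (begin-strict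
    C                            <⟨ C<D ⟩
    D                            ≡⟨ A+B≡D ⟨
    A ℕ.+ B                      ≤⟨ ℕ.+-mono-≤ (ℕ.m≤m+n A (p ℕ.* A)) (ℕ.m≤m+n B (q ℕ.* B)) ⟩
    suc p ℕ.* A ℕ.+ suc q ℕ.* B  ∎))
    where open ℕ.≤-Reasoning
  combination-of-C p       (suc (suc q)) B≢C eq = contradiction eq (ℕ.>⇒≢ (begin-strict
    C                            <⟨ C<D ⟩
    D                            ≤⟨ D≤2*B ⟩
    2 ℕ.* B                      ≤⟨ ℕ.*-monoˡ-≤ B (ℕ.m≤m+n 2 q) ⟩
    (2 ℕ.+ q) ℕ.* B              ≤⟨ ℕ.m≤n+m _ (p ℕ.* A) ⟩
    p ℕ.* A ℕ.+ (2 ℕ.+ q) ℕ.* B  ∎))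
    where open ℕ.≤-Reasoning

  combination-of-D+C : ∀ p q r → B ≢ C → 2 ℕ.* B ≢ D ℕ.+ C → 3 ℕ.* B ≢ D ℕ.+ C →
                       p ℕ.* A ℕ.+ q ℕ.* B ℕ.+ r ℕ.* D ≡ D ℕ.+ C →
                       q ℕ.< p × ∃[ s ] 0 ℕ.< s × (s ℕ.* A ≡ D ℕ.+ C ⊎ s ℕ.* A ≡ C)
  combination-of-D+C p q (suc (suc r)) _ _ _ eq = contradiction eq (ℕ.>⇒≢ (begin-strict
    D ℕ.+ C                                  <⟨ D+C<2*D ⟩
    2 ℕ.* D                                  ≤⟨ ℕ.*-monoˡ-≤ D (ℕ.m≤m+n 2 r) ⟩
    (2 ℕ.+ r) ℕ.* D                          ≤⟨ ℕ.m≤n+m _ (p ℕ.* A ℕ.+ q ℕ.* B) ⟩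
    p ℕ.* A ℕ.+ q ℕ.* B ℕ.+ (2 ℕ.+ r) ℕ.* D  ∎))
    where open ℕ.≤-Reasoning
  combination-of-D+C p q 1 B≢C _ _ eq
    with refl , 0<p , pA≡C ← combination-of-C p q B≢C (cancel-D (trans (cong (_ ℕ.+_) (sym (ℕ.+-identityʳ D))) eq))
    = 0<p , p , 0<p , inj₂ pA≡C
  combination-of-D+C zero    zero    0 _ _ _ eq = contradiction eq (ℕ.<⇒≢ (ℕ.<-≤-trans 0<C (ℕ.m≤n+m C D)))
  combination-of-D+C (suc p) zero    0 _ _ _ eq =
    z<s , suc p , z<s , inj₁ (trans (sym (ℕ.+-identityʳ _)) (trans (sym (ℕ.+-identityʳ _)) eq))
  combination-of-D+C (suc p) (suc q) 0 B≢C _ _ eq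
    with refl , 0<p , pA≡C ← combination-of-C p q B≢C (cancel-D (trans (sym (split-A+B p q)) eq))
    = s≤s 0<p , p , 0<p , inj₂ pA≡C
  combination-of-D+C zero 1 0 _ _ _ eq = contradiction eq (ℕ.<⇒≢ (begin-strict
    0 ℕ.* A ℕ.+ 1 ℕ.* B ℕ.+ 0 ℕ.* D  ≡⟨ solve (A ∷ B ∷ D ∷ []) ⟩
    B                                ≤⟨ ℕ.m≤n+m B A ⟩
    A ℕ.+ B                          ≡⟨ A+B≡D ⟩
    D                                <⟨ ℕ.m<m+n D 0<C ⟩
    D ℕ.+ C                          ∎))
    where open ℕ.≤-Reasoning
  combination-of-D+C zero 2 0 _ 2B≢D+C _ eq = contradiction (trans (sym (ℕ.+-identityʳ (2 ℕ.* B))) eq) 2B≢D+C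
  combination-of-D+C zero 3 0 _ _ 3B≢D+C eq = contradiction (trans (sym (ℕ.+-identityʳ (3 ℕ.* B))) eq) 3B≢D+C
  combination-of-D+C zero (suc (suc (suc (suc q)))) 0 _ _ _ eq = contradiction eq (ℕ.>⇒≢ (begin-strict
    D ℕ.+ C                                  <⟨ D+C<2*D ⟩
    2 ℕ.* D                                  ≤⟨ ℕ.*-monoʳ-≤ 2 D≤2*B ⟩
    2 ℕ.* (2 ℕ.* B)                          ≡⟨ solve (B ∷ []) ⟩
    4 ℕ.* B                                  ≤⟨ ℕ.*-monoˡ-≤ B (ℕ.m≤m+n 4 q) ⟩
    (4 ℕ.+ q) ℕ.* B                          ≡⟨ solve (A ∷ B ∷ D ∷ q ∷ []) ⟩
    0 ℕ.* A ℕ.+ (4 ℕ.+ q) ℕ.* B ℕ.+ 0 ℕ.* D  ∎))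
    where open ℕ.≤-Reasoning

-- k /ℕ suc d is definitionally fromℚᵘ (+ k ℚᵘ./ suc d), so facts about /ℕ reduce to ℚᵘ arithmetic.
cross-mult⇒/ℕ≡ : ∀ k {d} k′ {d′} .{{_ : NonZero d}} .{{_ : NonZero d′}} →
                 k ℕ.* d′ ≡ k′ ℕ.* d → k /ℕ d ≡ k′ /ℕ d′
cross-mult⇒/ℕ≡ k {suc d} k′ {suc d′} eq = ℚ.fromℚᵘ-cong {+ k ℚᵘ./ suc d} {+ k′ ℚᵘ./ suc d′} (*≡* (begin
  + k ℤ.* + suc d′    ≡⟨ ℤ.pos-* k (suc d′) ⟨
  + (k ℕ.* suc d′)    ≡⟨ cong +_ eq ⟩
  + (k′ ℕ.* suc d)    ≡⟨ ℤ.pos-* k′ (suc d) ⟩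
  + k′ ℤ.* + suc d    ∎))
  where open ≡-Reasoning

/ℕ≡⇒cross-mult : ∀ k {d} k′ {d′} .{{_ : NonZero d}} .{{_ : NonZero d′}} →
                 k /ℕ d ≡ k′ /ℕ d′ → k ℕ.* d′ ≡ k′ ℕ.* d
/ℕ≡⇒cross-mult k {suc d} k′ {suc d′} eq
  with *≡* eqℤ ← ℚᵘ.≃-trans (ℚᵘ.≃-sym (ℚ.toℚᵘ-fromℚᵘ (+ k ℚᵘ./ suc d)))
                   (ℚᵘ.≃-trans (ℚ.toℚᵘ-cong eq) (ℚ.toℚᵘ-fromℚᵘ (+ k′ ℚᵘ./ suc d′)))
  = ℤ.+-injective (begin
    + (k ℕ.* suc d′)    ≡⟨ ℤ.pos-* k (suc d′) ⟩
    + k ℤ.* + suc d′    ≡⟨ eqℤ ⟩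
    + k′ ℤ.* + suc d    ≡⟨ ℤ.pos-* k′ (suc d) ⟨
    + (k′ ℕ.* suc d)    ∎)
  where open ≡-Reasoning

/ℕ-* : ∀ k {d} k′ {d′} .{{_ : NonZero d}} .{{_ : NonZero d′}} →
       (k /ℕ d) * (k′ /ℕ d′) ≡ (k ℕ.* k′) /ℕ (d ℕ.* d′)
/ℕ-* k {suc d} k′ {suc d′} = ℚ.toℚᵘ-injective (begin
  toℚᵘ (k /ℕ suc d * k′ /ℕ suc d′)
    ≈⟨ ℚ.toℚᵘ-homo-* (k /ℕ suc d) (k′ /ℕ suc d′) ⟩
  toℚᵘ (k /ℕ suc d) ℚᵘ.* toℚᵘ (k′ /ℕ suc d′)
    ≈⟨ ℚᵘ.*-cong (ℚ.toℚᵘ-fromℚᵘ (+ k ℚᵘ./ suc d)) (ℚ.toℚᵘ-fromℚᵘ (+ k′ ℚᵘ./ suc d′)) ⟩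
  (+ k ℚᵘ./ suc d) ℚᵘ.* (+ k′ ℚᵘ./ suc d′)
    ≈⟨ *≡* (cong (ℤ._* + (suc d ℕ.* suc d′)) (sym (ℤ.pos-* k k′))) ⟩
  + (k ℕ.* k′) ℚᵘ./ (suc d ℕ.* suc d′)
    ≈⟨ ℚ.toℚᵘ-fromℚᵘ (+ (k ℕ.* k′) ℚᵘ./ (suc d ℕ.* suc d′)) ⟨
  toℚᵘ ((k ℕ.* k′) /ℕ (suc d ℕ.* suc d′))
    ∎)
  where open ℚᵘ.≃-Reasoning

/ℕ-+ : ∀ k k′ {d} .{{_ : NonZero d}} → k /ℕ d + k′ /ℕ d ≡ (k ℕ.+ k′) /ℕ d
/ℕ-+ k k′ {suc d} = ℚ.toℚᵘ-injective (begin
  toℚᵘ (k /ℕ suc d + k′ /ℕ suc d)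
    ≈⟨ ℚ.toℚᵘ-homo-+ (k /ℕ suc d) (k′ /ℕ suc d) ⟩
  toℚᵘ (k /ℕ suc d) ℚᵘ.+ toℚᵘ (k′ /ℕ suc d)
    ≈⟨ ℚᵘ.+-cong (ℚ.toℚᵘ-fromℚᵘ (+ k ℚᵘ./ suc d)) (ℚ.toℚᵘ-fromℚᵘ (+ k′ ℚᵘ./ suc d)) ⟩
  (+ k ℚᵘ./ suc d) ℚᵘ.+ (+ k′ ℚᵘ./ suc d)
    ≈⟨ *≡* (trans (distrib (+ k) (+ k′) (+ suc d)) (cong (+ (k ℕ.+ k′) ℤ.*_) (sym (ℤ.pos-* (suc d) (suc d))))) ⟩
  + (k ℕ.+ k′) ℚᵘ./ suc d
    ≈⟨ ℚ.toℚᵘ-fromℚᵘ (+ (k ℕ.+ k′) ℚᵘ./ suc d) ⟨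
  toℚᵘ ((k ℕ.+ k′) /ℕ suc d)
    ∎)
  where
  open ℚᵘ.≃-Reasoning
  distrib : ∀ K K′ S → (K ℤ.* S ℤ.+ K′ ℤ.* S) ℤ.* S ≡ (K ℤ.+ K′) ℤ.* (S ℤ.* S)
  distrib = ℤ-Solver.solve-∀

ℕ→ℚ-minus-/ℕ : ∀ k j l {d} .{{_ : NonZero d}} → l ℕ.+ j ≡ k ℕ.* d → ℕ→ℚ k - j /ℕ d ≡ l /ℕ d
ℕ→ℚ-minus-/ℕ k j l {d} l+j≡kd = begin
  ℕ→ℚ k - j /ℕ d              ≡⟨ cong (_- j /ℕ d) k≡l/d+j/d ⟩
  (l /ℕ d + j /ℕ d) - j /ℕ d  ≡⟨ ℚ.+-assoc (l /ℕ d) (j /ℕ d) (- (j /ℕ d)) ⟩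
  l /ℕ d + (j /ℕ d - j /ℕ d)  ≡⟨ cong (_+_ (l /ℕ d)) (ℚ.+-inverseʳ (j /ℕ d)) ⟩
  l /ℕ d + 0ℚ                 ≡⟨ ℚ.+-identityʳ (l /ℕ d) ⟩
  l /ℕ d                      ∎
  where
  open ≡-Reasoning
  k≡l/d+j/d : ℕ→ℚ k ≡ l /ℕ d + j /ℕ d
  k≡l/d+j/d = trans (cross-mult⇒/ℕ≡ k (l ℕ.+ j) (trans (sym l+j≡kd) (sym (ℕ.*-identityʳ _)))) (sym (/ℕ-+ l j))

ℕ→ℚ-as-/ℕ : ∀ k {d} .{{_ : NonZero d}} → ℕ→ℚ k ≡ (k ℕ.* d) /ℕ d
ℕ→ℚ-as-/ℕ k {d} = cross-mult⇒/ℕ≡ k (k ℕ.* d) (sym (ℕ.*-identityʳ (k ℕ.* d)))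

ℕ→ℚ-*-/ℕ : ∀ k j {d} .{{_ : NonZero d}} → ℕ→ℚ k * (j /ℕ d) ≡ (k ℕ.* j) /ℕ d
ℕ→ℚ-*-/ℕ k j {d} = trans (/ℕ-* k {1} j {d})
  (cross-mult⇒/ℕ≡ (k ℕ.* j) {1 ℕ.* d} (k ℕ.* j) {{ℕ.m*n≢0 1 d}} (cong ((k ℕ.* j) ℕ.*_) (sym (ℕ.*-identityˡ d))))

/ℕ-as-/ℕ-*-1/ℕ : ∀ m c s {d n} .{{_ : NonZero d}} .{{_ : NonZero n}} .{{_ : NonZero s}} →
                 s ℕ.* (n ℕ.* m) ≡ c ℕ.* d → m /ℕ d ≡ (c /ℕ n) * (1 /ℕ s)
/ℕ-as-/ℕ-*-1/ℕ m c s {d} {n} {{d≢0}} s[nm]≡cd =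
  trans (cross-mult⇒/ℕ≡ m {d} (c ℕ.* 1) {n ℕ.* s} {{d≢0}} {{ℕ.m*n≢0 n s}} (begin
    m ℕ.* (n ℕ.* s)  ≡⟨ solve (m ∷ n ∷ s ∷ []) ⟩
    s ℕ.* (n ℕ.* m)  ≡⟨ s[nm]≡cd ⟩
    c ℕ.* d          ≡⟨ cong (ℕ._* d) (ℕ.*-identityʳ c) ⟨
    c ℕ.* 1 ℕ.* d    ∎))
  (sym (/ℕ-* c {n} 1 {s}))
  where open ≡-Reasoning

positive-≤½-as-/ℕ : ∀ a → 0ℚ < a → a ℚ.≤ ½ → ∃₂ λ i e → suc i ≤ e × a ≡ suc i /ℕ (suc i ℕ.+ e)
positive-≤½-as-/ℕ (mkℚ (+ zero) _ _) (*<* (ℤ.+<+ ())) _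
positive-≤½-as-/ℕ (mkℚ -[1+ _ ] _ _) (*<* ()) _
positive-≤½-as-/ℕ a@(mkℚ (+ suc i) d-1 _) _ (*≤* (ℤ.+≤+ 2m≤d))
  with j , 2m+j≡d ← ℕ.m≤n⇒∃[o]m+o≡n 2m≤d =
  i , suc i ℕ.+ j , ℕ.m≤m+n (suc i) j , trans (sym (ℚ.fromℚᵘ-toℚᵘ a)) (cong (suc i /ℕ_) (begin
    suc d-1                  ≡⟨ ℕ.*-identityˡ (suc d-1) ⟨
    1 ℕ.* suc d-1            ≡⟨ 2m+j≡d ⟨
    suc i ℕ.* 2 ℕ.+ j        ≡⟨ solve (i ∷ j ∷ []) ⟩
    suc i ℕ.+ (suc i ℕ.+ j)  ∎))
  where open ≡-Reasoning

2-4/n≡ : ∀ t → ℕ→ℚ 2 - 4 /ℕ (4 ℕ.+ t) ≡ (4 ℕ.+ t ℕ.+ t) /ℕ (4 ℕ.+ t)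
2-4/n≡ t = ℕ→ℚ-minus-/ℕ 2 4 (4 ℕ.+ t ℕ.+ t) {4 ℕ.+ t} (solve (t ∷ []))

1-4/n≡ : ∀ t → 1ℚ - 4 /ℕ (4 ℕ.+ t) ≡ t /ℕ (4 ℕ.+ t)
1-4/n≡ t = ℕ→ℚ-minus-/ℕ 1 4 t {4 ℕ.+ t} (solve (t ∷ []))

1/3+4/3n≡ : ∀ n .{{_ : NonZero n}} → 1 /ℕ 3 + 4 /ℕ (3 ℕ.* n) ≡ (n ℕ.+ 4) /ℕ (3 ℕ.* n)
1/3+4/3n≡ n = trans (cong (_+ 4 /ℕ (3 ℕ.* n)) 1/3≡n/3n) (/ℕ-+ n 4 {{ℕ.m*n≢0 3 n}})
  where
  1/3≡n/3n : 1 /ℕ 3 ≡ n /ℕ (3 ℕ.* n)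
  1/3≡n/3n = cross-mult⇒/ℕ≡ 1 {3} n {3 ℕ.* n} {{_}} {{ℕ.m*n≢0 3 n}} (solve (n ∷ []))

module Scaled (t m e : ℕ) .{{_ : NonZero t}} .{{_ : NonZero (m ℕ.+ e)}} where

  n d : ℕ
  n = 4 ℕ.+ t
  d = m ℕ.+ e

  a : ℚ
  a = m /ℕ d

  combination-as-/ℕ : ∀ p q r →
                      ℕ→ℚ p * a + ℕ→ℚ q * (1ℚ - a) + ℕ→ℚ r ≡ (p ℕ.* m ℕ.+ q ℕ.* e ℕ.+ r ℕ.* d) /ℕ d
  combination-as-/ℕ p q r = begin
    ℕ→ℚ p * a + ℕ→ℚ q * (1ℚ - a) + ℕ→ℚ r
      ≡⟨ cong₂ (λ x y → ℕ→ℚ p * a + ℕ→ℚ q * x + y) 1-a≡e/d (ℕ→ℚ-as-/ℕ r) ⟩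
    ℕ→ℚ p * a + ℕ→ℚ q * (e /ℕ d) + (r ℕ.* d) /ℕ d
      ≡⟨ cong₂ (λ x y → x + y + (r ℕ.* d) /ℕ d) (ℕ→ℚ-*-/ℕ p m) (ℕ→ℚ-*-/ℕ q e) ⟩
    (p ℕ.* m) /ℕ d + (q ℕ.* e) /ℕ d + (r ℕ.* d) /ℕ d
      ≡⟨ cong (_+ (r ℕ.* d) /ℕ d) (/ℕ-+ (p ℕ.* m) (q ℕ.* e)) ⟩
    (p ℕ.* m ℕ.+ q ℕ.* e) /ℕ d + (r ℕ.* d) /ℕ d
      ≡⟨ /ℕ-+ (p ℕ.* m ℕ.+ q ℕ.* e) (r ℕ.* d) ⟩
    (p ℕ.* m ℕ.+ q ℕ.* e ℕ.+ r ℕ.* d) /ℕ d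
      ∎
    where
    open ≡-Reasoning
    1-a≡e/d : 1ℚ - a ≡ e /ℕ d
    1-a≡e/d = ℕ→ℚ-minus-/ℕ 1 m e (trans (ℕ.+-comm e m) (sym (ℕ.*-identityˡ d)))

  scaled-equation : ∀ p q r → ℕ→ℚ 2 - 4 /ℕ n ≡ ℕ→ℚ p * a + ℕ→ℚ q * (1ℚ - a) + ℕ→ℚ r →
                    p ℕ.* (n ℕ.* m) ℕ.+ q ℕ.* (n ℕ.* e) ℕ.+ r ℕ.* (n ℕ.* d) ≡ n ℕ.* d ℕ.+ t ℕ.* d
  scaled-equation p q r eq = begin
    p ℕ.* (n ℕ.* m) ℕ.+ q ℕ.* (n ℕ.* e) ℕ.+ r ℕ.* (n ℕ.* d)  ≡⟨ factor p q r m e d n ⟩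
    (p ℕ.* m ℕ.+ q ℕ.* e ℕ.+ r ℕ.* d) ℕ.* n                  ≡⟨ cross-multiplied ⟨
    (n ℕ.+ t) ℕ.* d                                          ≡⟨ ℕ.*-distribʳ-+ d n t ⟩
    n ℕ.* d ℕ.+ t ℕ.* d                                      ∎
    where
    open ≡-Reasoning
    factor : ∀ p q r m e d n → p ℕ.* (n ℕ.* m) ℕ.+ q ℕ.* (n ℕ.* e) ℕ.+ r ℕ.* (n ℕ.* d)
                             ≡ (p ℕ.* m ℕ.+ q ℕ.* e ℕ.+ r ℕ.* d) ℕ.* n
    factor = solve-∀
    cross-multiplied : (n ℕ.+ t) ℕ.* d ≡ (p ℕ.* m ℕ.+ q ℕ.* e ℕ.+ r ℕ.* d) ℕ.* n
    cross-multiplied = /ℕ≡⇒cross-mult (n ℕ.+ t) _ (trans (sym (2-4/n≡ t)) (trans eq (combination-as-/ℕ p q r)))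

  a≡4/n : n ℕ.* e ≡ t ℕ.* d → a ≡ 4 /ℕ n
  a≡4/n ne≡td = cross-mult⇒/ℕ≡ m 4 (ℕ.+-cancelʳ-≡ (t ℕ.* d) _ _ (begin
    m ℕ.* n ℕ.+ t ℕ.* d  ≡⟨ cong (m ℕ.* n ℕ.+_) ne≡td ⟨
    m ℕ.* n ℕ.+ n ℕ.* e  ≡⟨ expand t m e ⟩
    4 ℕ.* d ℕ.+ t ℕ.* d  ∎))
    where
    open ≡-Reasoning
    expand : ∀ t m e → m ℕ.* (4 ℕ.+ t) ℕ.+ (4 ℕ.+ t) ℕ.* e ≡ 4 ℕ.* (m ℕ.+ e) ℕ.+ t ℕ.* (m ℕ.+ e)
    expand = solve-∀

  a≡2/n : 2 ℕ.* (n ℕ.* e) ≡ n ℕ.* d ℕ.+ t ℕ.* d → a ≡ 2 /ℕ n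
  a≡2/n 2ne≡nd+td = cross-mult⇒/ℕ≡ m 2 (ℕ.*-cancelˡ-≡ _ _ 2 (ℕ.+-cancelʳ-≡ (n ℕ.* d ℕ.+ t ℕ.* d) _ _ (begin
    2 ℕ.* (m ℕ.* n) ℕ.+ (n ℕ.* d ℕ.+ t ℕ.* d)  ≡⟨ cong (2 ℕ.* (m ℕ.* n) ℕ.+_) 2ne≡nd+td ⟨
    2 ℕ.* (m ℕ.* n) ℕ.+ 2 ℕ.* (n ℕ.* e)        ≡⟨ expand t m e ⟩
    2 ℕ.* (2 ℕ.* d) ℕ.+ (n ℕ.* d ℕ.+ t ℕ.* d)  ∎)))
    where
    open ≡-Reasoning
    expand : ∀ t m e → 2 ℕ.* (m ℕ.* (4 ℕ.+ t)) ℕ.+ 2 ℕ.* ((4 ℕ.+ t) ℕ.* e)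
                     ≡ 2 ℕ.* (2 ℕ.* (m ℕ.+ e)) ℕ.+ ((4 ℕ.+ t) ℕ.* (m ℕ.+ e) ℕ.+ t ℕ.* (m ℕ.+ e))
    expand = solve-∀

  a≡1/3+4/3n : 3 ℕ.* (n ℕ.* e) ≡ n ℕ.* d ℕ.+ t ℕ.* d → a ≡ 1 /ℕ 3 + 4 /ℕ (3 ℕ.* n)
  a≡1/3+4/3n 3ne≡nd+td = trans (cross-mult⇒/ℕ≡ m (n ℕ.+ 4) (ℕ.+-cancelʳ-≡ (n ℕ.* d ℕ.+ t ℕ.* d) _ _ (begin
    m ℕ.* (3 ℕ.* n) ℕ.+ (n ℕ.* d ℕ.+ t ℕ.* d)  ≡⟨ cong (m ℕ.* (3 ℕ.* n) ℕ.+_) 3ne≡nd+td ⟨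
    m ℕ.* (3 ℕ.* n) ℕ.+ 3 ℕ.* (n ℕ.* e)        ≡⟨ expand t m e ⟩
    (n ℕ.+ 4) ℕ.* d ℕ.+ (n ℕ.* d ℕ.+ t ℕ.* d)  ∎))) (sym (1/3+4/3n≡ n))
    where
    open ≡-Reasoning
    expand : ∀ t m e → m ℕ.* (3 ℕ.* (4 ℕ.+ t)) ℕ.+ 3 ℕ.* ((4 ℕ.+ t) ℕ.* e)
                     ≡ (4 ℕ.+ t ℕ.+ 4) ℕ.* (m ℕ.+ e) ℕ.+ ((4 ℕ.+ t) ℕ.* (m ℕ.+ e) ℕ.+ t ℕ.* (m ℕ.+ e))
    expand = solve-∀

  a≡[2-4/n]/s : ∀ s .{{_ : NonZero s}} → s ℕ.* (n ℕ.* m) ≡ n ℕ.* d ℕ.+ t ℕ.* d →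
                a ≡ (ℕ→ℚ 2 - 4 /ℕ n) * (1 /ℕ s)
  a≡[2-4/n]/s s eq = trans (/ℕ-as-/ℕ-*-1/ℕ m (n ℕ.+ t) s (trans eq (sym (ℕ.*-distribʳ-+ d n t))))
                           (cong (_* 1 /ℕ s) (sym (2-4/n≡ t)))

  a≡[1-4/n]/s : ∀ s .{{_ : NonZero s}} → s ℕ.* (n ℕ.* m) ≡ t ℕ.* d → a ≡ (1ℚ - 4 /ℕ n) * (1 /ℕ s)
  a≡[1-4/n]/s s eq = trans (/ℕ-as-/ℕ-*-1/ℕ m t s eq) (cong (_* 1 /ℕ s) (sym (1-4/n≡ t)))

  private
    nm≤ne : m ≤ e → n ℕ.* m ≤ n ℕ.* e
    nm≤ne = ℕ.*-monoʳ-≤ n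

    nm+ne≡nd : n ℕ.* m ℕ.+ n ℕ.* e ≡ n ℕ.* d
    nm+ne≡nd = sym (ℕ.*-distribˡ-+ n m e)

    0<td : 0 ℕ.< t ℕ.* d
    0<td = ℕ.>-nonZero⁻¹ (t ℕ.* d) {{ℕ.m*n≢0 t d}}

    td<nd : t ℕ.* d ℕ.< n ℕ.* d
    td<nd = ℕ.*-monoˡ-< d (ℕ.m<n+m t {4} z<s)

  decomposition : m ≤ e → a ≢ 2 /ℕ n → a ≢ 4 /ℕ n → a ≢ 1 /ℕ 3 + 4 /ℕ (3 ℕ.* n) →
                  ∀ p q r → ℕ→ℚ 2 - 4 /ℕ n ≡ ℕ→ℚ p * a + ℕ→ℚ q * (1ℚ - a) + ℕ→ℚ r →
                  q ℕ.< p × ∃[ s ] 1 ≤ s × (a ≡ (ℕ→ℚ 2 - 4 /ℕ n) * (1 /ℕ s) ⊎ a ≡ (1ℚ - 4 /ℕ n) * (1 /ℕ s))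
  decomposition m≤e a≢2/n a≢4/n a≢1/3+4/3n p q r eq =
    let q<p , s , 0<s , cases = combination-of-D+C (nm≤ne m≤e) nm+ne≡nd 0<td td<nd p q r
                                  (a≢4/n ∘ a≡4/n) (a≢2/n ∘ a≡2/n) (a≢1/3+4/3n ∘ a≡1/3+4/3n)
                                  (scaled-equation p q r eq)
    in q<p , s , 0<s , Sum.map (a≡[2-4/n]/s s {{>-nonZero 0<s}}) (a≡[1-4/n]/s s {{>-nonZero 0<s}}) cases

lemma7 : (n : ℕ) → 5 ≤ n → (a : ℚ) → 0ℚ < a → a ℚ.≤ ½
         → a ≢ 2 /ℕ n → a ≢ 4 /ℕ n → a ≢ 1 /ℕ 3 + 4 /ℕ (3 ℕ.* n)
         → (p q r : ℕ)
         → ℕ→ℚ 2 - 4 /ℕ n ≡ ℕ→ℚ p * a + ℕ→ℚ q * (1ℚ - a) + ℕ→ℚ r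
         → (q ℕ.< p) × (∃[ s ] ((1 ≤ s) × ((a ≡ (ℕ→ℚ 2 - 4 /ℕ n) * (1 /ℕ s)) ⊎ (a ≡ (1ℚ - 4 /ℕ n) * (1 /ℕ s)))))
lemma7 (suc (suc (suc (suc (suc k))))) (s≤s (s≤s (s≤s (s≤s (s≤s _))))) a 0<a a≤½
  with i , e , m≤e , refl ← positive-≤½-as-/ℕ a 0<a a≤½
  = Scaled.decomposition (suc k) (suc i) e m≤e
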